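{- Let $V$ be a finite set of variables and let $\mathcal{B}$ be a Sperner family of nonempty proper subsets of $V$ with $\bigcup_{B\in\mathcal{B}}B=V$ and $\bigcap_{B\in\mathcal{B}}B=\emptyset$. Then $\mathrm{price}_C(B,B')=|B'\setminus B|$ for all $B,B'\in\mathcal{B}$.
   Context: A pure Horn clause $B\rightarrow v$, with $\emptyset\neq B\subseteq V$ and $v\in V\setminus B$, is the clause $v\vee\bigvee_{u\in B}\overline{u}$; $B$ is its body and $v$ its head. A pure Horn CNF is a conjunction of such clauses; $\mathcal{B}_\Phi$ is its set of bodies and $|\Phi|_C$ its number of (distinct) clauses. For $Z\subseteq V$, the closure $F_\Phi(Z)$ is the smallest superset of $Z$ whose characteristic vector satisfies $\Phi$ (obtained by forward chaining). For $S,T\subseteq V$, $\mathrm{price}_C(S,T)=\min\{|\Phi|_C:\Phi$ pure Horn CNF, $\mathcal{B}_\Phi\subseteq\mathcal{B}$, $T\subseteq F_\Phi(S)\}$. Sperner means no member of $\mathcal{B}$ is a proper subset of another. -}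

module Defs where

open import Data.Nat using (ℕ; _≤_)
open import Data.Fin using (Fin)
open import Data.Fin.Subset using (Subset; _∈_; _∉_; _⊆_; _⊂_; ⊤; Nonempty; _─_; ∣_∣)
open import Data.List using (List; length)
open import Data.List.Membership.Propositional using () renaming (_∈_ to _∈ₗ_)
open import Data.List.Relation.Unary.All using (All)
open import Data.List.Relation.Unary.Unique.Propositional using (Unique)
open import Data.Product using (Σ; ∃; _×_)
open import Relation.Nullary using (¬_)
open import Relation.Binary.PropositionalEquality using (_≡_)

record HornClause (n : ℕ) : Set where
  constructor _⇒_
  field
    body : Subset n
    head : Fin n
open HornClause public

IsPureHorn : ∀ {n} → HornClause n → Set
IsPureHorn C = Nonempty (body C) × head C ∉ body C

-- A pure Horn CNF: a duplicate-free list of pure Horn clauses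
-- (so that its length is the number of distinct clauses |Φ|_C).
record PureHornCNF (n : ℕ) : Set where
  field
    clauses  : List (HornClause n)
    pureHorn : All IsPureHorn clauses
    distinct : Unique clauses
open PureHornCNF public

size : ∀ {n} → PureHornCNF n → ℕ
size Φ = length (clauses Φ)

SatClause : ∀ {n} → Subset n → HornClause n → Set
SatClause Z C = body C ⊆ Z → head C ∈ Z

Satisfies : ∀ {n} → Subset n → PureHornCNF n → Set
Satisfies Z Φ = All (SatClause Z) (clauses Φ)

-- x ∈ F_Φ(S): x belongs to every superset of S whose characteristic
-- vector satisfies Φ (i.e. to the smallest such superset).
_∈Closure[_,_] : ∀ {n} → Fin n → PureHornCNF n → Subset n → Set
x ∈Closure[ Φ , S ] = ∀ Z → S ⊆ Z → Satisfies Z Φ → x ∈ Z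

_⊆Closure[_,_] : ∀ {n} → Subset n → PureHornCNF n → Subset n → Set
T ⊆Closure[ Φ , S ] = ∀ {x} → x ∈ T → x ∈Closure[ Φ , S ]

BodiesIn : ∀ {n} → PureHornCNF n → List (Subset n) → Set
BodiesIn Φ 𝓑 = All (λ C → body C ∈ₗ 𝓑) (clauses Φ)

Feasible : ∀ {n} → List (Subset n) → Subset n → Subset n → PureHornCNF n → Set
Feasible 𝓑 S T Φ = BodiesIn Φ 𝓑 × T ⊆Closure[ Φ , S ]

IsPriceC : ∀ {n} → List (Subset n) → Subset n → Subset n → ℕ → Set
IsPriceC 𝓑 S T k =
  (Σ (PureHornCNF _) λ Φ → Feasible 𝓑 S T Φ × size Φ ≡ k)
  × (∀ Φ → Feasible 𝓑 S T Φ → k ≤ size Φ)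

Sperner : ∀ {n} → List (Subset n) → Set
Sperner 𝓑 = ∀ {B B′} → B ∈ₗ 𝓑 → B′ ∈ₗ 𝓑 → ¬ (B ⊂ B′)

NonemptyProper : ∀ {n} → Subset n → Set
NonemptyProper B = Nonempty B × ¬ (B ≡ ⊤)

CoversV : ∀ {n} → List (Subset n) → Set
CoversV {n} 𝓑 = ∀ (v : Fin n) → ∃ λ B → B ∈ₗ 𝓑 × v ∈ B

EmptyIntersection : ∀ {n} → List (Subset n) → Set
EmptyIntersection {n} 𝓑 = ∀ (v : Fin n) → ∃ λ B → B ∈ₗ 𝓑 × v ∉ B

-- Forward chaining adds a variable outside S to the closure of S only by
-- firing a clause with that head: V ∖ {x} is a model of every clause whose
-- head is not x.  So making all of B′ ∖ B derivable from B takes at least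
-- ∣B′ ∖ B∣ clauses, and the clauses B → v, v ∈ B′ ∖ B, achieve that bound.
module Submission where

open import Defs
open import Data.Nat using (ℕ; suc; _≤_; z≤n; s≤s)
open import Data.Nat.Properties using (n≤1+n; ≤-trans; ≤-reflexive)
open import Data.Fin using (Fin; zero; suc; _≟_)
open import Data.Fin.Properties using (suc-injective)
open import Data.Fin.Subset
  using (Subset; Nonempty; _─_; _-_; ∣_∣; ⁅_⁆; ∁; inside; outside)
  renaming (_∈_ to _∈ₛ_; _∉_ to _∉ₛ_; _⊆_ to _⊆ₛ_)
open import Data.Fin.Subset.Properties
  using (_∈?_; x∈⁅x⁆; x∈p⇒x∉∁p; x∉p⇒x∈∁p; x≢y⇒x∉⁅y⁆; x∈p∧x∉q⇒x∈p─q; p─q⊆p; p─⊥≡p)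
open import Data.Vec using ([]; _∷_; here; there)
open import Data.List using (List; []; _∷_; map; length)
open import Data.List.Properties using (length-map)
open import Data.List.Membership.Propositional using (_∈_)
open import Data.List.Membership.Propositional.Properties using (∈-map⁺; ∈-map⁻)
open import Data.List.Relation.Unary.All as All using (All)
open import Data.List.Relation.Unary.All.Properties using ()
  renaming (map⁺ to All-map⁺)
open import Data.List.Relation.Unary.Any using (here; there; any?)
open import Data.List.Relation.Unary.Unique.Propositional using (Unique)
open import Data.List.Relation.Unary.Unique.Propositional.Properties using ()
  renaming (map⁺ to Unique-map⁺)
open import Data.List.Relation.Unary.AllPairs using ([]; _∷_)
open import Data.Product using (_,_; proj₁)
open import Relation.Nullary using (yes; no; contradiction)
open import Relation.Binary.PropositionalEquality using (_≡_; refl; sym; cong; trans; subst)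

private
  variable
    n : ℕ

toList : Subset n → List (Fin n)
toList []            = []
toList (inside  ∷ p) = zero ∷ map suc (toList p)
toList (outside ∷ p) = map suc (toList p)

length-toList : (p : Subset n) → length (toList p) ≡ ∣ p ∣
length-toList []            = refl
length-toList (inside  ∷ p) = cong suc (trans (length-map suc (toList p)) (length-toList p))
length-toList (outside ∷ p) = trans (length-map suc (toList p)) (length-toList p)

∈-toList⁺ : (p : Subset n) {x : Fin n} → x ∈ₛ p → x ∈ toList p
∈-toList⁺ (inside  ∷ p) here        = here refl
∈-toList⁺ (inside  ∷ p) (there x∈p) = there (∈-map⁺ suc (∈-toList⁺ p x∈p))
∈-toList⁺ (outside ∷ p) (there x∈p) = ∈-map⁺ suc (∈-toList⁺ p x∈p)

∈-toList⁻ : (p : Subset n) {x : Fin n} → x ∈ toList p → x ∈ₛ p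
∈-toList⁻ (inside ∷ p) (here refl) = here
∈-toList⁻ (inside ∷ p) (there x∈) with ∈-map⁻ suc x∈
... | _ , y∈ , refl = there (∈-toList⁻ p y∈)
∈-toList⁻ (outside ∷ p) x∈ with ∈-map⁻ suc x∈
... | _ , y∈ , refl = there (∈-toList⁻ p y∈)

toList-unique : (p : Subset n) → Unique (toList p)
toList-unique []            = []
toList-unique (inside  ∷ p) =
  All-map⁺ (All.universal (λ _ ()) (toList p)) ∷ Unique-map⁺ suc-injective (toList-unique p)
toList-unique (outside ∷ p) = Unique-map⁺ suc-injective (toList-unique p)

x∈p─q⇒x∉q : (p q : Subset n) {x : Fin n} → x ∈ₛ p ─ q → x ∉ₛ q
x∈p─q⇒x∉q (inside ∷ p) (outside ∷ q) here        ()
x∈p─q⇒x∉q (_      ∷ p) (_       ∷ q) (there x∈) (there x∈q) = x∈p─q⇒x∉q p q x∈ x∈q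

∣p∣≤1+∣p-x∣ : (p : Subset n) (x : Fin n) → ∣ p ∣ ≤ suc ∣ p - x ∣
∣p∣≤1+∣p-x∣ (inside  ∷ p) zero    = ≤-reflexive (cong (λ q → suc ∣ q ∣) (sym (p─⊥≡p p)))
∣p∣≤1+∣p-x∣ (outside ∷ p) zero    = ≤-trans (n≤1+n _) (≤-reflexive (cong (λ q → suc ∣ q ∣) (sym (p─⊥≡p p))))
∣p∣≤1+∣p-x∣ (inside  ∷ p) (suc x) = s≤s (∣p∣≤1+∣p-x∣ p x)
∣p∣≤1+∣p-x∣ (outside ∷ p) (suc x) = ∣p∣≤1+∣p-x∣ p x

∣p∣≤length : (p : Subset n) (xs : List (Fin n)) → (∀ {x} → x ∈ₛ p → x ∈ xs) → ∣ p ∣ ≤ length xs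
∣p∣≤length []            [] _ = z≤n
∣p∣≤length (inside  ∷ p) [] p⊆xs with () ← p⊆xs here
∣p∣≤length (outside ∷ p) [] p⊆xs = ∣p∣≤length p [] (λ x∈p → contradiction (p⊆xs (there x∈p)) λ ())
∣p∣≤length p (y ∷ ys) p⊆xs =
  ≤-trans (∣p∣≤1+∣p-x∣ p y) (s≤s (∣p∣≤length (p - y) ys p-y⊆ys))
  where
  p-y⊆ys : ∀ {x} → x ∈ₛ p - y → x ∈ ys
  p-y⊆ys x∈ with p⊆xs (p─q⊆p p ⁅ y ⁆ x∈)
  ... | here refl = contradiction (x∈⁅x⁆ y) (x∈p─q⇒x∉q p ⁅ y ⁆ x∈)
  ... | there x∈ys = x∈ys

heads : PureHornCNF n → List (Fin n)
heads Φ = map head (clauses Φ)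

∈Closure∧∉⇒∈heads : (Φ : PureHornCNF n) {S : Subset n} {x : Fin n} →
  x ∈Closure[ Φ , S ] → x ∉ₛ S → x ∈ heads Φ
∈Closure∧∉⇒∈heads Φ {S} {x} x∈F x∉S with any? (x ≟_) (heads Φ)
... | yes x∈heads = x∈heads
... | no  x∉heads = contradiction (x∈F (∁ ⁅ x ⁆) S⊆V-x V-x⊨Φ) (x∈p⇒x∉∁p (x∈⁅x⁆ x))
  where
  S⊆V-x : S ⊆ₛ ∁ ⁅ x ⁆
  S⊆V-x {y} y∈S = x∉p⇒x∈∁p (x≢y⇒x∉⁅y⁆ λ { refl → x∉S y∈S })
  V-x⊨Φ : Satisfies (∁ ⁅ x ⁆) Φ
  V-x⊨Φ = All.tabulate λ {C} C∈Φ _ →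
    x∉p⇒x∈∁p (x≢y⇒x∉⁅y⁆ λ { refl → x∉heads (∈-map⁺ head C∈Φ) })

∣T─S∣≤size : (Φ : PureHornCNF n) {S T : Subset n} → T ⊆Closure[ Φ , S ] → ∣ T ─ S ∣ ≤ size Φ
∣T─S∣≤size Φ {S} {T} T⊆F =
  subst (∣ T ─ S ∣ ≤_) (length-map head (clauses Φ)) (∣p∣≤length (T ─ S) (heads Φ) T─S⊆heads)
  where
  T─S⊆heads : ∀ {x} → x ∈ₛ T ─ S → x ∈ heads Φ
  T─S⊆heads x∈ = ∈Closure∧∉⇒∈heads Φ (T⊆F (p─q⊆p T S x∈)) (x∈p─q⇒x∉q T S x∈)

fanOut : (S T : Subset n) → Nonempty S → PureHornCNF n
fanOut S T S≢∅ = record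
  { clauses  = map (S ⇒_) (toList (T ─ S))
  ; pureHorn = All-map⁺ (All.tabulate λ x∈ → S≢∅ , x∈p─q⇒x∉q T S (∈-toList⁻ (T ─ S) x∈))
  ; distinct = Unique-map⁺ (cong head) (toList-unique (T ─ S))
  }

size-fanOut : (S T : Subset n) (S≢∅ : Nonempty S) → size (fanOut S T S≢∅) ≡ ∣ T ─ S ∣
size-fanOut S T _ = trans (length-map (S ⇒_) (toList (T ─ S))) (length-toList (T ─ S))

fanOut-bodies : {𝓑 : List (Subset n)} {S : Subset n} (T : Subset n) (S≢∅ : Nonempty S) →
  S ∈ 𝓑 → BodiesIn (fanOut S T S≢∅) 𝓑
fanOut-bodies T _ S∈𝓑 = All-map⁺ (All.tabulate λ _ → S∈𝓑)

fanOut-closure : (S T : Subset n) (S≢∅ : Nonempty S) → T ⊆Closure[ fanOut S T S≢∅ , S ]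
fanOut-closure S T _ {x} x∈T Z S⊆Z Z⊨Φ with x ∈? S
... | yes x∈S = S⊆Z x∈S
... | no  x∉S = All.lookup Z⊨Φ (∈-map⁺ (S ⇒_) (∈-toList⁺ (T ─ S) (x∈p∧x∉q⇒x∈p─q x∈T x∉S))) S⊆Z

nonemptyBody⇒isPriceC : {𝓑 : List (Subset n)} {S : Subset n} (T : Subset n) →
  Nonempty S → S ∈ 𝓑 → IsPriceC 𝓑 S T ∣ T ─ S ∣
nonemptyBody⇒isPriceC {S = S} T S≢∅ S∈𝓑 =
  ( fanOut S T S≢∅
  , (fanOut-bodies T S≢∅ S∈𝓑 , fanOut-closure S T S≢∅)
  , size-fanOut S T S≢∅ )
  , λ Φ (_ , T⊆F) → ∣T─S∣≤size Φ T⊆F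

lemma5 : (n : ℕ) (𝓑 : List (Subset n)) →
    Sperner 𝓑 → All NonemptyProper 𝓑 → CoversV 𝓑 → EmptyIntersection 𝓑 →
    ∀ {B B′} → B ∈ 𝓑 → B′ ∈ 𝓑 → IsPriceC 𝓑 B B′ ∣ B′ ─ B ∣
lemma5 n 𝓑 _ nonemptyProper _ _ {B} {B′} B∈𝓑 _ =
  nonemptyBody⇒isPriceC B′ (proj₁ (All.lookup nonemptyProper B∈𝓑)) B∈𝓑
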